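{- Let $\mathcal{X}=(\Omega,S)$ be a homogeneous coherent configuration with maximum valency $k$, let $X=S_k$, and fix $\alpha\in\Omega$. Let $x,y,z\in X$ and $r,s,t\in S$ satisfy $x\sim z\sim y$, $r\in x^*z$, $s\in z^*y$, $t\in x^*y$, and put $T=(x,r,z,s,y,t)$. If the set $N(x,y,z)$ contains a $T$-special element, then $r_{x,z}\cdot s_{z,y}\subseteq t_{x,y}$.
   Context: A coherent configuration on a finite set $\Omega$ is a pair $(\Omega,S)$, $S$ a partition of $\Omega\times\Omega$ such that the diagonal $1_\Omega$ is a union of elements of $S$, $S$ is closed under $s\mapsto s^*=\{(\beta,\alpha):(\alpha,\beta)\in s\}$, and for $r,s,t\in S$ the number $|\beta r\cap\gamma s^*|$ (where $\beta r=\{\delta:(\beta,\delta)\in r\}$) does not depend on $(\beta,\gamma)\in t$. It is homogeneous if $1_\Omega\in S$; $n_s=|\beta s|$ is the valency, $S_k=\{s\in S:n_s=k\}$. For relations, $a\cdot b=\{(\beta,\delta):\exists\gamma,(\beta,\gamma)\in a,(\gamma,\delta)\in b\}$; for $u,v\in S$, $uv$ denotes the set of basis relations contained in $u\cdot v$. For $x,y\in X$, $x\sim y$ means $|x^*y|=k$; $N(x,y,z)=\{q\in X: q\sim x, q\sim y, q\sim z\}$. For $r,x,y\in S$, $r_{x,y}=r\cap(\alpha x\times\alpha y)$. An element $q\in N(x,y,z)$ is $T$-special if there are $u\in x^*q$, $v\in z^*q$, $w\in y^*q$ with $uv^*\cap x^*z=\{r\}$, $vw^*\cap z^*y=\{s\}$,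 and $uw^*\cap x^*y=\{t\}$. -}

module Defs where

open import Data.Nat using (ℕ; _≤_)
open import Data.Fin using (Fin; _≟_)
open import Data.List using (List; length; filter; allFin)
open import Data.List.Membership.Propositional using (_∈_)
open import Data.List.Relation.Unary.Unique.Propositional using (Unique)
open import Data.Product using (Σ; ∃; ∃-syntax; _×_; _,_)
open import Relation.Nullary.Decidable using (_×-dec_)
open import Relation.Binary.PropositionalEquality using (_≡_)
open import Function.Bundles using (_⇔_)

BRel : ℕ → Set₁
BRel n = Fin n → Fin n → Set

_ᵀ : ∀ {n} → BRel n → BRel n
(a ᵀ) β γ = a γ β

_·_ : ∀ {n} → BRel n → BRel n → BRel n
(a · b) β δ = ∃[ γ ] (a β γ × b γ δ)

HasSize : ∀ {m} → (Fin m → Set) → ℕ → Set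
HasSize {m} P k = Σ (List (Fin m)) λ xs → Unique xs × length xs ≡ k × (∀ w → (w ∈ xs) ⇔ P w)

-- A coherent configuration on Ω = Fin n whose set S of basis relations is
-- indexed by Fin m: the partition S is given by a colouring of Ω×Ω whose
-- colour classes (the basis relations) are all nonempty.
record CoherentConfiguration (n m : ℕ) : Set where
  field
    colour   : Fin n → Fin n → Fin m
    nonempty : ∀ (i : Fin m) → ∃[ β ] ∃[ γ ] colour β γ ≡ i
    -- the diagonal is a union of basis relations
    diagUnion : ∀ β γ δ → colour β β ≡ colour γ δ → γ ≡ δ
    transposeClosed : ∀ (i : Fin m) → ∃[ j ] (∀ β γ → (colour β γ ≡ i) ⇔ (colour γ β ≡ j))
    -- intersection numbers: |βr ∩ γs*| depends only on the basis relation containing (β,γ)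
    coherent : ∀ (r s t : Fin m) → ∃[ p ] (∀ β γ → colour β γ ≡ t →
                 length (filter (λ δ → (colour β δ ≟ r) ×-dec (colour δ γ ≟ s)) (allFin n)) ≡ p)

module _ {n m : ℕ} (𝒳 : CoherentConfiguration n m) where
  open CoherentConfiguration 𝒳

  ⟦_⟧ : Fin m → BRel n
  ⟦ i ⟧ β γ = colour β γ ≡ i

  Homogeneous : Set
  Homogeneous = ∃[ e ] (∀ β γ → (colour β γ ≡ e) ⇔ (β ≡ γ))

  valencyAt : Fin n → Fin m → ℕ
  valencyAt β s = length (filter (λ δ → colour β δ ≟ s) (allFin n))

  -- w belongs to the complex product "ab": basis relation w is contained in a·b
  InProd : Fin m → BRel n → BRel n → Set
  InProd w a b = ∀ β δ → colour β δ ≡ w → (a · b) β δ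

  IsMaxValency : Fin n → ℕ → Set
  IsMaxValency α k = (∀ s → valencyAt α s ≤ k) × (∃[ s ] valencyAt α s ≡ k)

  InX : Fin n → ℕ → Fin m → Set
  InX α k x = valencyAt α x ≡ k

  Sim : ℕ → Fin m → Fin m → Set
  Sim k x y = HasSize (λ w → InProd w (⟦ x ⟧ ᵀ) ⟦ y ⟧) k

  InN : Fin n → ℕ → Fin m → Fin m → Fin m → Fin m → Set
  InN α k x y z q = InX α k q × Sim k q x × Sim k q y × Sim k q z

  MeetIsSingleton : BRel n → BRel n → BRel n → BRel n → Fin m → Set
  MeetIsSingleton a b c d r = ∀ w → (InProd w a b × InProd w c d) ⇔ (w ≡ r)

  TSpecial : Fin m → Fin m → Fin m → Fin m → Fin m → Fin m → Fin m → Set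
  TSpecial x r z s y t q =
    ∃[ u ] ∃[ v ] ∃[ w ]
      ( InProd u (⟦ x ⟧ ᵀ) ⟦ q ⟧ × InProd v (⟦ z ⟧ ᵀ) ⟦ q ⟧ × InProd w (⟦ y ⟧ ᵀ) ⟦ q ⟧
      × MeetIsSingleton ⟦ u ⟧ (⟦ v ⟧ ᵀ) (⟦ x ⟧ ᵀ) ⟦ z ⟧ r
      × MeetIsSingleton ⟦ v ⟧ (⟦ w ⟧ ᵀ) (⟦ z ⟧ ᵀ) ⟦ y ⟧ s
      × MeetIsSingleton ⟦ u ⟧ (⟦ w ⟧ ᵀ) (⟦ x ⟧ ᵀ) ⟦ y ⟧ t )

  Restrict : Fin n → Fin m → Fin m → Fin m → BRel n
  Restrict α r x y β γ = colour α β ≡ x × colour α γ ≡ y × colour β γ ≡ r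

module Submission where

-- Let β ∈ αx, γ ∈ αz, δ ∈ αy with
-- (β,γ) ∈ r and (γ,δ) ∈ s, and let q be T-special via u, v, w.  Since
-- u ∈ x*q we find ε ∈ αq with (β,ε) ∈ u; since v ∈ z*q and w ∈ y*q we find
-- γ' ∈ αz, δ' ∈ αy with (γ',ε) ∈ v and (δ',ε) ∈ w.  The colour of (β,γ')
-- lies in uv* ∩ x*z = {r}, so (β,γ') ∈ r.  Because x ∼ z, the colouring
-- γ ↦ c(β,γ) is injective on αz (it maps the k points of αz onto the k
-- colours of x*z), hence γ' = γ.  In the same way (γ,δ') ∈ s forces δ' = δ,
-- and finally the colour of (β,δ) lies in uw* ∩ x*y = {t}.

open import Defs
open import Data.Nat using (ℕ)
open import Data.Fin using (Fin)
open import Data.Product using (∃-syntax; _×_)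

open import Data.Nat using (suc; _≤_; s≤s; z≤n)
open import Data.Nat.Properties using (≤-refl; n≮n; module ≤-Reasoning)
import Data.Fin as Fin
open import Data.List using (List; []; _∷_; length; filter; allFin; map)
open import Data.List.Properties using (length-map; length-removeAt′)
open import Data.List.Membership.Propositional using (_∈_)
open import Data.List.Membership.Propositional.Properties
  using (∈-filter⁺; ∈-filter⁻; ∈-allFin; ∈-map⁺; ∈-map⁻)
open import Data.List.Relation.Unary.Any using (here; there; _─_; index)
open import Data.List.Relation.Unary.All using () renaming (lookup to All-lookup)
open import Data.List.Relation.Unary.AllPairs.Core using (_∷_)
open import Data.List.Relation.Unary.Unique.Propositional using (Unique)
open import Data.Product using (∃; _,_; proj₁; proj₂)
open import Data.Empty using (⊥-elim)
open import Relation.Nullary using (¬_; Dec; yes; no)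
open import Relation.Nullary.Decidable using (_×-dec_)
open import Relation.Binary using (DecidableEquality)
open import Relation.Binary.PropositionalEquality using (_≡_; refl; sym; trans; subst)
open import Function.Bundles using (Equivalence)
open Equivalence using (to; from)

module _ {A : Set} where

  ∈-─⁺ : ∀ {a b} {xs : List A} (a∈xs : a ∈ xs) → b ∈ xs → ¬ b ≡ a → b ∈ (xs ─ a∈xs)
  ∈-─⁺ (here refl) (here refl)  b≢a = ⊥-elim (b≢a refl)
  ∈-─⁺ (here refl) (there b∈xs) b≢a = b∈xs
  ∈-─⁺ (there a∈xs) (here b≡x)  b≢a = here b≡x
  ∈-─⁺ (there a∈xs) (there b∈xs) b≢a = there (∈-─⁺ a∈xs b∈xs b≢a)

  unique-⊆-length : ∀ {xs ys : List A} → Unique xs → (∀ {a} → a ∈ xs → a ∈ ys) →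
                    length xs ≤ length ys
  unique-⊆-length {[]}     _             _  = z≤n
  unique-⊆-length {a ∷ xs} {ys} (a∉xs ∷ uxs) xs⊆ys = begin
    suc (length xs)           ≤⟨ s≤s (unique-⊆-length uxs xs⊆ys─a) ⟩
    suc (length (ys ─ a∈ys))  ≡⟨ sym (length-removeAt′ ys (index a∈ys)) ⟩
    length ys                 ∎
    where
    open ≤-Reasoning
    a∈ys : a ∈ ys
    a∈ys = xs⊆ys (here refl)
    xs⊆ys─a : ∀ {b} → b ∈ xs → b ∈ (ys ─ a∈ys)
    xs⊆ys─a b∈xs = ∈-─⁺ a∈ys (xs⊆ys (there b∈xs)) (λ b≡a → All-lookup a∉xs b∈xs (sym b≡a))

  nonempty-by-length : ∀ {xs ys : List A} {y : A} → length xs ≡ length ys → y ∈ ys → ∃ λ x → x ∈ xs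
  nonempty-by-length {x ∷ _} _    _ = x , here refl
  nonempty-by-length {[]} () (here _)
  nonempty-by-length {[]} () (there _)

covering-injective : ∀ {A B : Set} → DecidableEquality A → (f : A → B) (L : List A) (M : List B) →
  Unique M → (∀ {b} → b ∈ M → b ∈ map f L) → length L ≤ length M →
  ∀ {a a'} → a ∈ L → a' ∈ L → f a ≡ f a' → a ≡ a'
covering-injective {A} _≟_ f L M uM M⊆fL |L|≤|M| {a} {a'} a∈L a'∈L fa≡fa' with a ≟ a'
... | yes a≡a' = a≡a'
... | no  a≢a' = ⊥-elim (n≮n (length L) (begin-strict
      length L                   ≤⟨ |L|≤|M| ⟩
      length M                   ≤⟨ unique-⊆-length uM M⊆fL' ⟩
      length (map f L')          ≡⟨ length-map f L' ⟩
      length L'                  <⟨ ≤-refl ⟩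
      suc (length L')            ≡⟨ sym (length-removeAt′ L (index a'∈L)) ⟩
      length L                   ∎))
  where
  open ≤-Reasoning
  L' : List A
  L' = L ─ a'∈L
  -- every point c of L has a stand-in in L' with the same image: c itself, or a if c = a'
  M⊆fL' : ∀ {b} → b ∈ M → b ∈ map f L'
  M⊆fL' b∈M with ∈-map⁻ f (M⊆fL b∈M)
  ... | c , c∈L , b≡fc with c ≟ a'
  ...   | yes refl = subst (_∈ map f L') (sym (trans b≡fc (sym fa≡fa')))
                       (∈-map⁺ f (∈-─⁺ a'∈L a∈L a≢a'))
  ...   | no  c≢a' = subst (_∈ map f L') (sym b≡fc) (∈-map⁺ f (∈-─⁺ a'∈L c∈L c≢a'))

module _ {n m : ℕ} (𝒳 : CoherentConfiguration n m) where
  open CoherentConfiguration 𝒳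

  _* : Fin m → Fin m
  i * = proj₁ (transposeClosed i)

  *-intro : ∀ {i} β γ → colour β γ ≡ i → colour γ β ≡ i *
  *-intro {i} β γ = to (proj₂ (transposeClosed i) β γ)

  *-elim : ∀ {i} β γ → colour γ β ≡ i * → colour β γ ≡ i
  *-elim {i} β γ = from (proj₂ (transposeClosed i) β γ)

  via? : ∀ (a b : Fin m) β δ γ → Dec (colour β γ ≡ a × colour γ δ ≡ b)
  via? a b β δ γ = (colour β γ Fin.≟ a) ×-dec (colour γ δ Fin.≟ b)

  -- The intersection number p^t_{ab} counts the paths β -a→ γ -b→ δ; since it
  -- depends only on the colour t of (β,δ), such a path exists over (β,δ) as
  -- soon as it exists over some pair of the same colour.
  liftPath : ∀ {a b} β γ δ β' δ' → colour β γ ≡ a → colour γ δ ≡ b →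
             colour β' δ' ≡ colour β δ → ∃ λ γ' → colour β' γ' ≡ a × colour γ' δ' ≡ b
  liftPath {a} {b} β γ δ β' δ' βγ γδ sameColour with coherent a b (colour β δ)
  ... | _ , count with nonempty-by-length (trans (count β' δ' sameColour) (sym (count β δ refl)))
                         (∈-filter⁺ (via? a b β δ) (∈-allFin γ) (βγ , γδ))
  ... | γ' , γ'∈ = γ' , proj₂ (∈-filter⁻ (via? a b β' δ') {xs = allFin n} γ'∈)

  pathInProd : ∀ {a b} β γ δ → colour β γ ≡ a → colour γ δ ≡ b →
               InProd 𝒳 (colour β δ) (⟦ 𝒳 ⟧ a) (⟦ 𝒳 ⟧ b)
  pathInProd β γ δ βγ γδ β' δ' = liftPath β γ δ β' δ' βγ γδ

  InProd-mono : ∀ {w} {A A' B B' : BRel n} → (∀ β γ → A β γ → A' β γ) → (∀ β γ → B β γ → B' β γ) →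
                InProd 𝒳 w A B → InProd 𝒳 w A' B'
  InProd-mono A⊆A' B⊆B' wInAB β δ βδ with wInAB β δ βδ
  ... | γ , βγ , γδ = γ , A⊆A' β γ βγ , B⊆B' γ δ γδ

  inProd-*· : ∀ {a b} β γ δ → colour γ β ≡ a → colour γ δ ≡ b →
              InProd 𝒳 (colour β δ) (⟦ 𝒳 ⟧ a ᵀ) (⟦ 𝒳 ⟧ b)
  inProd-*· β γ δ γβ γδ =
    InProd-mono (λ β' γ' → *-elim γ' β') (λ _ _ e → e) (pathInProd β γ δ (*-intro γ β γβ) γδ)

  inProd-·* : ∀ {a b} β γ δ → colour β γ ≡ a → colour δ γ ≡ b →
              InProd 𝒳 (colour β δ) (⟦ 𝒳 ⟧ a) (⟦ 𝒳 ⟧ b ᵀ)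
  inProd-·* β γ δ βγ δγ =
    InProd-mono (λ _ _ e → e) (λ γ' δ' → *-elim δ' γ') (pathInProd β γ δ βγ (*-intro δ γ δγ))

  completeFromLeft : ∀ {a b c α β} → InProd 𝒳 c (⟦ 𝒳 ⟧ a ᵀ) (⟦ 𝒳 ⟧ b) → colour α β ≡ a →
                     ∃ λ γ → colour α γ ≡ b × colour β γ ≡ c
  completeFromLeft {c = c} {α} {β} cIna*b αβ with nonempty c
  ... | β₀ , γ₀ , β₀γ₀ with cIna*b β₀ γ₀ β₀γ₀
  ... | α₀ , α₀β₀ , α₀γ₀ with liftPath α₀ γ₀ β₀ α β α₀γ₀ (*-intro β₀ γ₀ β₀γ₀) (trans αβ (sym α₀β₀))
  ... | γ , αγ , γβ = γ , αγ , *-elim β γ γβ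

  completeFromRight : ∀ {a b c α γ} → InProd 𝒳 c (⟦ 𝒳 ⟧ a ᵀ) (⟦ 𝒳 ⟧ b) → colour α γ ≡ b →
                      ∃ λ β → colour α β ≡ a × colour β γ ≡ c
  completeFromRight {c = c} {α} {γ} cIna*b αγ with nonempty c
  ... | β₀ , γ₀ , β₀γ₀ with cIna*b β₀ γ₀ β₀γ₀
  ... | α₀ , α₀β₀ , α₀γ₀ = liftPath α₀ β₀ γ₀ α γ α₀β₀ β₀γ₀ (trans αγ (sym α₀γ₀))

  -- If a ∼ b and |αb| = k, then for β ∈ αa the colouring γ ↦ c(β,γ) is
  -- injective on αb: it maps the k points of αb onto the k colours of a*b.
  sim-injective : ∀ {k a b α β} → Sim 𝒳 k a b → InX 𝒳 α k b → colour α β ≡ a →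
                  ∀ {γ γ'} → colour α γ ≡ b → colour α γ' ≡ b → colour β γ ≡ colour β γ' → γ ≡ γ'
  sim-injective {a = a} {b} {α} {β} (M , uniqueM , |M|≡k , M↔a*b) |αb|≡k αβ αγ αγ' =
    covering-injective Fin._≟_ (colour β) αb M uniqueM M⊆colours |αb|≤|M|
      (∈-filter⁺ inαb? (∈-allFin _) αγ) (∈-filter⁺ inαb? (∈-allFin _) αγ')
    where
    inαb? : ∀ δ → Dec (colour α δ ≡ b)
    inαb? δ = colour α δ Fin.≟ b
    αb : List (Fin n)
    αb = filter inαb? (allFin n)
    |αb|≤|M| : length αb ≤ length M
    |αb|≤|M| = subst (_≤ length M) (trans |M|≡k (sym |αb|≡k)) ≤-refl
    M⊆colours : ∀ {w} → w ∈ M → w ∈ map (colour β) αb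
    M⊆colours {w} w∈M with completeFromLeft {a} {b} {w} (to (M↔a*b w) w∈M) αβ
    ... | γ , αγ , βγ = subst (_∈ map (colour β) αb) βγ (∈-map⁺ (colour β) (∈-filter⁺ inαb? (∈-allFin γ) αγ))

  meetColour : ∀ {u v x z r α β γ ε} → MeetIsSingleton 𝒳 (⟦ 𝒳 ⟧ u) (⟦ 𝒳 ⟧ v ᵀ) (⟦ 𝒳 ⟧ x ᵀ) (⟦ 𝒳 ⟧ z) r →
               colour β ε ≡ u → colour γ ε ≡ v → colour α β ≡ x → colour α γ ≡ z → colour β γ ≡ r
  meetColour {β = β} {γ} {ε} meet βε γε αβ αγ =
    to (meet (colour β γ)) (inProd-·* β ε γ βε γε , inProd-*· β _ γ αβ αγ)

lemma5p4 : ∀ {n m : ℕ} (𝒳 : CoherentConfiguration n m) → Homogeneous 𝒳 →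
    (α : Fin n) (k : ℕ) → IsMaxValency 𝒳 α k →
    (x y z r s t : Fin m) →
    InX 𝒳 α k x → InX 𝒳 α k y → InX 𝒳 α k z →
    Sim 𝒳 k x z → Sim 𝒳 k z y →
    InProd 𝒳 r (⟦ 𝒳 ⟧ x ᵀ) (⟦ 𝒳 ⟧ z) →
    InProd 𝒳 s (⟦ 𝒳 ⟧ z ᵀ) (⟦ 𝒳 ⟧ y) →
    InProd 𝒳 t (⟦ 𝒳 ⟧ x ᵀ) (⟦ 𝒳 ⟧ y) →
    (∃[ q ] (InN 𝒳 α k x y z q × TSpecial 𝒳 x r z s y t q)) →
    ∀ β δ → (Restrict 𝒳 α r x z · Restrict 𝒳 α s z y) β δ → Restrict 𝒳 α t x y β δ
lemma5p4 𝒳 _ α k _ x y z r s t _ |αy|≡k |αz|≡k x∼z z∼y _ _ _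
  (q , _ , u , v , w , u∈x*q , v∈z*q , w∈y*q , meetR , meetS , meetT)
  β δ (γ , (αβ , αγ , βγ) , (_ , αδ , γδ))
  -- the common neighbour ε ∈ αq and the points γ' ∈ αz, δ' ∈ αy joined to it by v, w
  with completeFromLeft 𝒳 u∈x*q αβ
... | ε , αε , βε with completeFromRight 𝒳 v∈z*q αε | completeFromRight 𝒳 w∈y*q αε
... | γ' , αγ' , γ'ε | δ' , αδ' , δ'ε
  -- (β,γ') ∈ r as (β,γ) is, so γ' = γ by x ∼ z
  with sim-injective 𝒳 x∼z |αz|≡k αβ αγ αγ' (trans βγ (sym (meetColour 𝒳 meetR βε γ'ε αβ αγ')))
... | refl
  -- (γ,δ') ∈ s as (γ,δ) is, so δ' = δ by z ∼ y
  with sim-injective 𝒳 z∼y |αy|≡k αγ αδ αδ' (trans γδ (sym (meetColour 𝒳 meetS γ'ε δ'ε αγ αδ')))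
... | refl = αβ , αδ , meetColour 𝒳 meetT βε δ'ε αβ αδ
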